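{- If $G$ is a (finite, simple) bipartite graph without isolated vertices, then $\chi'_{sCF}(G)\leq 3$.
   Context: For a graph $H$ and a vertex $v$, let $E_H(v)$ be the set of edges of $H$ incident to $v$, and for a pair $u,v$ let $E_H[uv]=E_H(u)\cup E_H(v)$. Given a graph $G$ and an edge colouring $c$ (not necessarily proper) of some subgraph $H$ of $G$, an edge $e$ of $G$ is satisfied by $c$ if the multiset $\{c(e'): e'\in E_H[e]\}$ contains a colour occurring exactly once in it. The parameter $\chi'_{sCF}(G)$ is the least number of colours for which there exist a subgraph $H$ of $G$ and an edge colouring of $H$ with that many colours satisfying every edge of $G$. -}

module Defs where

open import Data.Nat using (ℕ)
open import Data.Fin using (Fin)
open import Data.Bool using (Bool; true; false)
open import Data.Maybe using (Maybe; just; nothing)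
open import Data.Product using (Σ; ∃; ∃-syntax; _×_; _,_)
open import Data.Sum using (_⊎_)
open import Relation.Binary.PropositionalEquality using (_≡_; _≢_)

record Graph (n : ℕ) : Set where
  field
    adj     : Fin n → Fin n → Bool
    adj-sym : ∀ u v → adj u v ≡ adj v u
    irrefl  : ∀ v → adj v v ≡ false

open Graph public

Edge : ∀ {n} → Graph n → Fin n → Fin n → Set
Edge G u v = adj G u v ≡ true

Bipartite : ∀ {n} → Graph n → Set
Bipartite {n} G = Σ (Fin n → Bool) λ side → ∀ u v → Edge G u v → side u ≢ side v

NoIsolated : ∀ {n} → Graph n → Set
NoIsolated {n} G = ∀ v → ∃[ w ] Edge G v w

-- A (not necessarily proper) edge colouring with k colours of a subgraph
-- H of G is encoded as a symmetric map c : Fin n → Fin n → Maybe (Fin k):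
-- an edge xy of G belongs to H iff c x y ≢ nothing, and then its colour
-- is the value c x y.  (Values on non-edges of G are irrelevant.)
SymColouring : ℕ → ℕ → Set
SymColouring n k = Fin n → Fin n → Maybe (Fin k)

IsSymmetric : ∀ {n k} → SymColouring n k → Set
IsSymmetric {n} c = ∀ (x y : Fin n) → c x y ≡ c y x

SameEdge : ∀ {n} → Fin n → Fin n → Fin n → Fin n → Set
SameEdge x y x' y' = (x ≡ x' × y ≡ y') ⊎ (x ≡ y' × y ≡ x')

-- xy is an edge of G incident to u or to v (the edge set E_H[uv] is then
-- obtained by additionally requiring c x y ≢ nothing).
IncidentTo : ∀ {n} → Graph n → Fin n → Fin n → Fin n → Fin n → Set
IncidentTo G u v x y = Edge G x y × (x ≡ u ⊎ x ≡ v ⊎ y ≡ u ⊎ y ≡ v)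

-- The edge uv is satisfied by c: some colour i occurs exactly once in the
-- multiset {c(e') : e' ∈ E_H[uv]}, i.e. there is an edge xy ∈ E_H[uv] with
-- colour i, and every edge of E_H[uv] with colour i is that same edge.
Satisfied : ∀ {n k} → Graph n → SymColouring n k → Fin n → Fin n → Set
Satisfied {n} {k} G c u v =
  Σ (Fin k) λ i → Σ (Fin n) λ x → Σ (Fin n) λ y →
    IncidentTo G u v x y × c x y ≡ just i ×
    (∀ x' y' → IncidentTo G u v x' y' → c x' y' ≡ just i → SameEdge x y x' y')

SCFColourable : ∀ {n} → Graph n → ℕ → Set
SCFColourable {n} G k =
  Σ (SymColouring n k) λ c → IsSymmetric c × (∀ u v → Edge G u v → Satisfied G c u v)

-- Let every vertex x choose a neighbour p x, and let H consist of the edges x (p x)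
-- with x on the left side A; the edge x (p x) is coloured through x.  Among the
-- senders of a right vertex b (the x ∈ A with p x = b), two get colours 0 and 1 and
-- all others 2, while a lone sender gets 2.  For an edge ab with a ∈ A, E_H[ab]
-- consists of a (p a) and the edges of the senders of b.  If b has two senders or
-- more, whichever of colours 0, 1 a does not use is unique; if b has no sender
-- besides a, the edge a (p a) is unique.  If b has a single sender m ≠ a (coloured
-- 2), a must have colour 0 or 1, i.e. p a must have exactly two senders.  A choice
-- p with this property is found by local search: when it fails, redirecting a to b
-- lowers the number of vertices with exactly one sender.

module Submission where

open import Defs
open import Data.Nat using (ℕ; zero; suc; _<_)
open import Data.Nat.Induction using (<-wellFounded)
open import Induction.WellFounded using (Acc; acc)
open import Data.Bool using (Bool; true; false; not)
open import Data.Bool.Properties using (¬-not) renaming (_≟_ to _≟ᵇ_)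
open import Data.Fin using (Fin; zero; suc; _≟_)
open import Data.Fin.Patterns using (0F; 1F; 2F)
open import Data.Fin.Properties using (any?; all?)
open import Data.Fin.Subset using (Subset; Side; inside; outside; _∈_; _⊂_; ∣_∣)
open import Data.Fin.Subset.Properties using (p⊂q⇒∣p∣<∣q∣)
open import Data.Vec using ([]; _∷_; here; there)
open import Data.Vec.Functional using (updateAt)
open import Data.Vec.Functional.Properties using (updateAt-updates; updateAt-minimal)
open import Data.Maybe using (Maybe; just; nothing)
open import Data.Product using (∃-syntax; _×_; _,_; proj₁; proj₂)
open import Data.Sum using (_⊎_; inj₁; inj₂)
open import Function using (_∘_; const)
open import Relation.Nullary using (Dec; yes; no; ¬_; contradiction)
open import Relation.Nullary.Decidable using (_×-dec_; _→-dec_; ¬?; decidable-stable)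
open import Relation.Unary using (Decidable)
open import Relation.Binary.PropositionalEquality using (_≡_; _≢_; refl; sym; trans; cong; subst)

descent : {A : Set} (μ : A → ℕ) {P Q : A → Set} →
          (∀ x → P x → Q x ⊎ ∃[ y ] P y × μ y < μ x) →
          ∀ x → P x → ∃[ y ] P y × Q y
descent μ {P} {Q} step x = go x (<-wellFounded (μ x))
  where
  go : ∀ x → Acc _<_ (μ x) → P x → ∃[ y ] P y × Q y
  go x (acc rs) px with step x px
  ... | inj₁ qx = x , px , qx
  ... | inj₂ (y , py , μy<μx) = go y (rs μy<μx) py

subset : ∀ {n} {P : Fin n → Set} → Decidable P → Subset n
subset {zero}  P? = []
subset {suc n} P? = membership (P? zero) ∷ subset (P? ∘ suc)
  where
  membership : ∀ {A : Set} → Dec A → Side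
  membership (yes _) = inside
  membership (no _)  = outside

∈-subset⁺ : ∀ {n} {P : Fin n → Set} (P? : Decidable P) {x} → P x → x ∈ subset P?
∈-subset⁺ P? {zero} px with P? zero
... | yes _  = here
... | no ¬px = contradiction px ¬px
∈-subset⁺ P? {suc x} px = there (∈-subset⁺ (P? ∘ suc) px)

∈-subset⁻ : ∀ {n} {P : Fin n → Set} (P? : Decidable P) {x} → x ∈ subset P? → P x
∈-subset⁻ P? {zero} x∈ with P? zero
∈-subset⁻ P? {zero} x∈ | yes px = px
∈-subset⁻ P? {zero} () | no _
∈-subset⁻ P? {suc x} (there x∈) = ∈-subset⁻ (P? ∘ suc) x∈

rank : ∀ {n} → Fin n → Fin n → Fin n → Fin 3
rank z m₀ m₁ with z ≟ m₀ | z ≟ m₁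
... | yes _ | _     = 0F
... | no _  | yes _ = 1F
... | no _  | no _  = 2F

module _ {n} {m₀ m₁ : Fin n} where

  rank-first : rank m₀ m₀ m₁ ≡ 0F
  rank-first with m₀ ≟ m₀ | m₀ ≟ m₁
  ... | yes _    | _ = refl
  ... | no m₀≢m₀ | _ = contradiction refl m₀≢m₀

  rank-second : m₀ ≢ m₁ → rank m₁ m₀ m₁ ≡ 1F
  rank-second m₀≢m₁ with m₁ ≟ m₀ | m₁ ≟ m₁
  ... | yes m₁≡m₀ | _        = contradiction (sym m₁≡m₀) m₀≢m₁
  ... | no _      | yes _    = refl
  ... | no _      | no m₁≢m₁ = contradiction refl m₁≢m₁

  rank≡0F : ∀ {z} → rank z m₀ m₁ ≡ 0F → z ≡ m₀
  rank≡0F {z} with z ≟ m₀ | z ≟ m₁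
  ... | yes z≡m₀ | _     = λ _ → z≡m₀
  ... | no _     | yes _ = λ ()
  ... | no _     | no _  = λ ()

  rank≡1F : ∀ {z} → rank z m₀ m₁ ≡ 1F → z ≡ m₁
  rank≡1F {z} with z ≟ m₀ | z ≟ m₁
  ... | yes _ | _        = λ ()
  ... | no _  | yes z≡m₁ = λ _ → z≡m₁
  ... | no _  | no _     = λ ()

  rank≢2F : ∀ {z} → m₀ ≢ m₁ → z ≡ m₀ ⊎ z ≡ m₁ → rank z m₀ m₁ ≢ 2F
  rank≢2F _     (inj₁ refl) r = contradiction (trans (sym rank-first) r) λ ()
  rank≢2F m₀≢m₁ (inj₂ refl) r = contradiction (trans (sym (rank-second m₀≢m₁)) r) λ ()

module _ {n} (G : Graph n) where

  edge-sym : ∀ {u v} → Edge G u v → Edge G v u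
  edge-sym {u} {v} e = trans (adj-sym G v u) e

  incidentTo-sym : ∀ {u v x y} → IncidentTo G u v x y → IncidentTo G v u x y
  incidentTo-sym (e , inj₁ x≡u)               = e , inj₂ (inj₁ x≡u)
  incidentTo-sym (e , inj₂ (inj₁ x≡v))        = e , inj₁ x≡v
  incidentTo-sym (e , inj₂ (inj₂ (inj₁ y≡u))) = e , inj₂ (inj₂ (inj₂ y≡u))
  incidentTo-sym (e , inj₂ (inj₂ (inj₂ y≡v))) = e , inj₂ (inj₂ (inj₁ y≡v))

  incidentTo-flip : ∀ {u v x y} → IncidentTo G u v x y → IncidentTo G u v y x
  incidentTo-flip {u} {v} {x} {y} (e , ends) = edge-sym e , flip ends
    where
    flip : x ≡ u ⊎ x ≡ v ⊎ y ≡ u ⊎ y ≡ v → y ≡ u ⊎ y ≡ v ⊎ x ≡ u ⊎ x ≡ v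
    flip (inj₁ x≡u)               = inj₂ (inj₂ (inj₁ x≡u))
    flip (inj₂ (inj₁ x≡v))        = inj₂ (inj₂ (inj₂ x≡v))
    flip (inj₂ (inj₂ (inj₁ y≡u))) = inj₁ y≡u
    flip (inj₂ (inj₂ (inj₂ y≡v))) = inj₂ (inj₁ y≡v)

  satisfied-sym : ∀ {k} {c : SymColouring n k} {u v} → Satisfied G c u v → Satisfied G c v u
  satisfied-sym (i , x , y , inc , cxy , unique) =
    i , x , y , incidentTo-sym inc , cxy ,
    λ x′ y′ inc′ → unique x′ y′ (incidentTo-sym inc′)

module Bipartition {n} (G : Graph n) (side : Fin n → Bool)
                   (bipartite : ∀ u v → Edge G u v → side u ≢ side v) where

  Left : Fin n → Set
  Left y = side y ≡ false

  left-neighbour-not-left : ∀ {a b} → Left a → Edge G a b → ¬ Left b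
  left-neighbour-not-left {a} {b} la e lb = bipartite a b e (trans la (sym lb))

  neighbour-of-right-is-left : ∀ {u v} → Edge G u v → ¬ Left u → Left v
  neighbour-of-right-is-left {u} {v} e ¬lu =
    trans (¬-not (bipartite v u (edge-sym G e))) (cong not (¬-not ¬lu))

  Choice : Set
  Choice = Fin n → Fin n

  ChoosesNeighbours : Choice → Set
  ChoosesNeighbours p = ∀ x → Edge G x (p x)

  Sends : Choice → Fin n → Fin n → Set
  Sends p y b = Left y × p y ≡ b

  Sends? : ∀ p y b → Dec (Sends p y b)
  Sends? p y b = (side y ≟ᵇ false) ×-dec (p y ≟ b)

  DegreeOne : Choice → Fin n → Set
  DegreeOne p b = ∃[ w ] Sends p w b × (∀ y → Sends p y b → y ≡ w)

  DegreeOne? : ∀ p b → Dec (DegreeOne p b)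
  DegreeOne? p b = any? λ w → Sends? p w b ×-dec all? λ y → Sends? p y b →-dec (y ≟ w)

  redirect : Choice → Fin n → Fin n → Choice
  redirect p a b = updateAt p a (const b)

  module _ {p : Choice} {a b : Fin n} where

    redirect-self : redirect p a b a ≡ b
    redirect-self = updateAt-updates a p

    redirect-other : ∀ {y} → y ≢ a → redirect p a b y ≡ p y
    redirect-other {y} y≢a = updateAt-minimal y a p y≢a

    redirect-chooses : ChoosesNeighbours p → Edge G a b → ChoosesNeighbours (redirect p a b)
    redirect-chooses chooses e y with y ≟ a
    ... | yes refl = subst (Edge G y) (sym redirect-self) e
    ... | no y≢a  = subst (Edge G y) (sym (redirect-other y≢a)) (chooses y)

    degreeOne-redirect : ∀ {x} → x ≢ b → x ≢ p a → DegreeOne (redirect p a b) x → DegreeOne p x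
    degreeOne-redirect {x} x≢b x≢pa (w , sw , only-w) = w , back sw , λ y sy → only-w y (forth sy)
      where
      back : ∀ {y} → Sends (redirect p a b) y x → Sends p y x
      back {y} (ly , ry≡x) with y ≟ a
      ... | yes refl = contradiction (trans (sym redirect-self) ry≡x) (x≢b ∘ sym)
      ... | no y≢a  = ly , trans (sym (redirect-other y≢a)) ry≡x
      forth : ∀ {y} → Sends p y x → Sends (redirect p a b) y x
      forth {y} (ly , py≡x) with y ≟ a
      ... | yes refl = contradiction (sym py≡x) x≢pa
      ... | no y≢a  = ly , trans (redirect-other y≢a) py≡x

    degreeOne-lost : Left a → ¬ Sends p a b → DegreeOne p b → ¬ DegreeOne (redirect p a b) b
    degreeOne-lost la ¬sab (w , sw , _) (_ , _ , only) =
      w≢a (trans (only w sw′) (sym (only a (la , redirect-self))))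
      where
      w≢a : w ≢ a
      w≢a w≡a = ¬sab (subst (λ y → Sends p y b) w≡a sw)
      sw′ : Sends (redirect p a b) w b
      sw′ = proj₁ sw , trans (redirect-other w≢a) (proj₂ sw)

    other-sender : ¬ Sends p a b → DegreeOne (redirect p a b) (p a) →
                   ∃[ w ] w ≢ a × Sends p w (p a) × (∀ y → Sends p y (p a) → y ≢ a → y ≡ w)
    other-sender ¬sab (w , (lw , rw≡pa) , only) =
      w , w≢a , (lw , trans (sym (redirect-other w≢a)) rw≡pa) ,
      λ y (ly , py≡pa) y≢a → only y (ly , trans (redirect-other y≢a) py≡pa)
      where
      w≢a : w ≢ a
      w≢a w≡a = ¬sab (subst Left w≡a lw ,
                      trans (sym (trans (cong (redirect p a b) (sym w≡a)) rw≡pa)) redirect-self)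

  Move : Choice → Fin n → Fin n → Set
  Move p a b = Left a × Edge G a b × DegreeOne p b × ¬ Sends p a b

  Stable : Choice → Set
  Stable p = ∀ a b → Move p a b → DegreeOne (redirect p a b) (p a)

  Unstable : Choice → Set
  Unstable p = ∃[ a ] ∃[ b ] Move p a b × ¬ DegreeOne (redirect p a b) (p a)

  unstable? : ∀ p → Dec (Unstable p)
  unstable? p = any? λ a → any? λ b →
    ((side a ≟ᵇ false) ×-dec (adj G a b ≟ᵇ true) ×-dec DegreeOne? p b ×-dec ¬? (Sends? p a b))
    ×-dec ¬? (DegreeOne? (redirect p a b) (p a))

  degreeOneSet : Choice → Subset n
  degreeOneSet p = subset (DegreeOne? p)

  move-shrinks : ∀ {p a b} → Move p a b → ¬ DegreeOne (redirect p a b) (p a) →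
                 degreeOneSet (redirect p a b) ⊂ degreeOneSet p
  move-shrinks {p} {a} {b} (la , _ , db , ¬sab) ¬dpa =
    kept , b , ∈-subset⁺ (DegreeOne? p) db , degreeOne-lost la ¬sab db ∘ ∈-subset⁻ _
    where
    kept : ∀ {x} → x ∈ degreeOneSet (redirect p a b) → x ∈ degreeOneSet p
    kept {x} x∈ with x ≟ b | x ≟ p a
    ... | yes refl | _        = contradiction (∈-subset⁻ _ x∈) (degreeOne-lost la ¬sab db)
    ... | no _     | yes refl = contradiction (∈-subset⁻ _ x∈) ¬dpa
    ... | no x≢b   | no x≢pa  = ∈-subset⁺ _ (degreeOne-redirect x≢b x≢pa (∈-subset⁻ _ x∈))

  stable-or-improvable : ∀ p → ChoosesNeighbours p →
                         Stable p ⊎ ∃[ q ] ChoosesNeighbours q × ∣ degreeOneSet q ∣ < ∣ degreeOneSet p ∣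
  stable-or-improvable p chooses with unstable? p
  ... | yes (a , b , move@(_ , e , _) , ¬d) =
    inj₂ (redirect p a b , redirect-chooses chooses e , p⊂q⇒∣p∣<∣q∣ (move-shrinks move ¬d))
  ... | no ¬unstable =
    inj₁ λ a b move → decidable-stable (DegreeOne? _ _) λ ¬d → ¬unstable (a , b , move , ¬d)

  stable-choice : NoIsolated G → ∃[ p ] ChoosesNeighbours p × Stable p
  stable-choice noIsolated =
    descent (λ p → ∣ degreeOneSet p ∣) stable-or-improvable
      (λ x → proj₁ (noIsolated x)) (λ x → proj₂ (noIsolated x))

  module Colouring (p : Choice) (chooses : ChoosesNeighbours p) (stable : Stable p) where

    data Fibre (b : Fin n) : Set where
      empty    : (∀ y → ¬ Sends p y b) → Fibre b
      single   : DegreeOne p b → Fibre b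
      multiple : ∀ m₀ m₁ → Sends p m₀ b → Sends p m₁ b → m₀ ≢ m₁ → Fibre b

    fibre : ∀ b → Fibre b
    fibre b with any? (λ y → Sends? p y b)
    ... | no none = empty (λ y sy → none (y , sy))
    ... | yes (m₀ , s₀) with any? (λ y → Sends? p y b ×-dec ¬? (y ≟ m₀))
    ...   | yes (m₁ , s₁ , m₁≢m₀) = multiple m₀ m₁ s₀ s₁ (m₁≢m₀ ∘ sym)
    ...   | no none =
      single (m₀ , s₀ , λ y sy → decidable-stable (y ≟ m₀) λ y≢m₀ → none (y , sy , y≢m₀))

    colourIn : ∀ {b} → Fin n → Fibre b → Fin 3
    colourIn z (multiple m₀ m₁ _ _ _) = rank z m₀ m₁
    colourIn z _                      = 2F

    colour : Fin n → Fin 3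
    colour z = colourIn z (fibre (p z))

    colour-sender : ∀ {z b} → Sends p z b → colour z ≡ colourIn z (fibre b)
    colour-sender {z} (_ , pz≡b) = cong (λ b → colourIn z (fibre b)) pz≡b

    -- By stability, p a has exactly two senders, so a is one of the two senders coloured 0 or 1.
    move-colour≢2F : ∀ {a b} → Move p a b → colour a ≢ 2F
    move-colour≢2F {a} {b} move@(la , _ , _ , ¬sab) with other-sender ¬sab (stable a b move)
    ... | w , w≢a , sw , only-w = pair-colour (fibre (p a))
      where
      pair-colour : (f : Fibre (p a)) → colourIn a f ≢ 2F
      pair-colour (empty none) = contradiction (la , refl) (none a)
      pair-colour (single (m , _ , only-m)) =
        contradiction (trans (only-m w sw) (sym (only-m a (la , refl)))) w≢a
      pair-colour (multiple m₀ m₁ s₀ s₁ m₀≢m₁) = rank≢2F m₀≢m₁ (a-is-m₀-or-m₁ (a ≟ m₀) (a ≟ m₁))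
        where
        a-is-m₀-or-m₁ : Dec (a ≡ m₀) → Dec (a ≡ m₁) → a ≡ m₀ ⊎ a ≡ m₁
        a-is-m₀-or-m₁ (yes a≡m₀) _          = inj₁ a≡m₀
        a-is-m₀-or-m₁ (no _)     (yes a≡m₁) = inj₂ a≡m₁
        a-is-m₀-or-m₁ (no a≢m₀)  (no a≢m₁)  =
          contradiction (trans (only-w m₀ s₀ (a≢m₀ ∘ sym)) (sym (only-w m₁ s₁ (a≢m₁ ∘ sym)))) m₀≢m₁

    -- H-edges are named by their left end z; the edge z (p z) lies in E_H[ab] iff Near a b z.
    Near : Fin n → Fin n → Fin n → Set
    Near a b z = Left z × (z ≡ a ⊎ p z ≡ b)

    UniqueColourNear : Fin n → Fin n → Set
    UniqueColourNear a b = ∃[ z ] Near a b z × (∀ z′ → Near a b z′ → colour z′ ≡ colour z → z′ ≡ z)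

    unique-colour-near : ∀ {a b} → Left a → Edge G a b → UniqueColourNear a b
    unique-colour-near {a} {b} la e = by-fibre (fibre b) colour-sender
      where
      near-sender : ∀ {z} → Sends p z b → Near a b z
      near-sender (lz , pz≡b) = lz , inj₂ pz≡b

      only-a : (∀ z → Sends p z b → z ≡ a) → UniqueColourNear a b
      only-a senders = a , (la , inj₁ refl) , λ where
        z′ (_ , inj₁ z′≡a)      _ → z′≡a
        z′ (lz′ , inj₂ pz′≡b)   _ → senders z′ (lz′ , pz′≡b)

      by-fibre : (f : Fibre b) → (∀ {z} → Sends p z b → colour z ≡ colourIn z f) → UniqueColourNear a b
      by-fibre (empty none) _ = only-a λ z sz → contradiction sz (none z)
      by-fibre (single (m , sm , only-m)) colours with Sends? p a b
      ... | yes sab = only-a λ z sz → trans (only-m z sz) (sym (only-m a sab))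
      ... | no ¬sab = m , near-sender sm , λ where
        z′ (_ , inj₁ refl) c →
          contradiction (trans c (colours sm)) (move-colour≢2F (la , e , (m , sm , only-m) , ¬sab))
        z′ (lz′ , inj₂ pz′≡b) _ → only-m z′ (lz′ , pz′≡b)
      by-fibre (multiple m₀ m₁ s₀ s₁ m₀≢m₁) colours = pick (colour a ≟ 0F)
        where
        colour-m₀ : colour m₀ ≡ 0F
        colour-m₀ = trans (colours s₀) rank-first
        colour-m₁ : colour m₁ ≡ 1F
        colour-m₁ = trans (colours s₁) (rank-second m₀≢m₁)
        pick : Dec (colour a ≡ 0F) → UniqueColourNear a b
        pick (yes ca≡0F) = m₁ , near-sender s₁ , λ where
          z′ (_ , inj₁ refl) c → contradiction (trans (sym ca≡0F) (trans c colour-m₁)) λ ()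
          z′ (lz′ , inj₂ pz′≡b) c → rank≡1F (trans (sym (colours (lz′ , pz′≡b))) (trans c colour-m₁))
        pick (no ca≢0F) = m₀ , near-sender s₀ , λ where
          z′ (_ , inj₁ refl) c → contradiction (trans c colour-m₀) ca≢0F
          z′ (lz′ , inj₂ pz′≡b) c → rank≡0F (trans (sym (colours (lz′ , pz′≡b))) (trans c colour-m₀))

    sends-to-right : ∀ {x y} → Sends p x y → ¬ Left y
    sends-to-right {x} (lx , px≡y) = left-neighbour-not-left lx (subst (Edge G x) px≡y (chooses x))

    edgeColour : ∀ x y → Dec (Sends p x y) → Dec (Sends p y x) → Maybe (Fin 3)
    edgeColour x y (yes _) _       = just (colour x)
    edgeColour x y (no _)  (yes _) = just (colour y)
    edgeColour x y (no _)  (no _)  = nothing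

    colouring : SymColouring n 3
    colouring x y = edgeColour x y (Sends? p x y) (Sends? p y x)

    colouring-sym : IsSymmetric colouring
    colouring-sym x y = edgeColour-sym (Sends? p x y) (Sends? p y x)
      where
      edgeColour-sym : ∀ dxy dyx → edgeColour x y dxy dyx ≡ edgeColour y x dyx dxy
      edgeColour-sym (yes sxy) (yes syx) = contradiction (proj₁ syx) (sends-to-right sxy)
      edgeColour-sym (yes _)   (no _)    = refl
      edgeColour-sym (no _)    (yes _)   = refl
      edgeColour-sym (no _)    (no _)    = refl

    colouring-sends : ∀ {x y} → Sends p x y → colouring x y ≡ just (colour x)
    colouring-sends {x} {y} sxy with Sends? p x y
    ... | yes _    = refl
    ... | no ¬sxy = contradiction sxy ¬sxy

    colouring≡just : ∀ {x y i} → colouring x y ≡ just i →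
                     (Sends p x y × colour x ≡ i) ⊎ (Sends p y x × colour y ≡ i)
    colouring≡just {x} {y} with Sends? p x y | Sends? p y x
    ... | yes sxy | _       = λ { refl → inj₁ (sxy , refl) }
    ... | no _    | yes syx = λ { refl → inj₂ (syx , refl) }
    ... | no _    | no _    = λ ()

    near-of-incident : ∀ {a b x y} → Left a → Edge G a b →
                       Sends p x y → IncidentTo G a b x y → Near a b x
    near-of-incident la e (lx , _)   (_ , inj₁ x≡a) = lx , inj₁ x≡a
    near-of-incident la e (lx , _)   (_ , inj₂ (inj₁ x≡b)) =
      contradiction (subst Left x≡b lx) (left-neighbour-not-left la e)
    near-of-incident la e sxy        (_ , inj₂ (inj₂ (inj₁ y≡a))) =
      contradiction (subst Left (sym y≡a) la) (sends-to-right sxy)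
    near-of-incident la e (lx , px≡y) (_ , inj₂ (inj₂ (inj₂ y≡b))) = lx , inj₂ (trans px≡y y≡b)

    satisfied-left : ∀ {a b} → Left a → Edge G a b → Satisfied G colouring a b
    satisfied-left {a} {b} la e with unique-colour-near la e
    ... | z , (lz , z-near) , unique =
      colour z , z , p z , (chooses z , ends z-near) , colouring-sends (lz , refl) , only
      where
      ends : z ≡ a ⊎ p z ≡ b → z ≡ a ⊎ z ≡ b ⊎ p z ≡ a ⊎ p z ≡ b
      ends (inj₁ z≡a)   = inj₁ z≡a
      ends (inj₂ pz≡b) = inj₂ (inj₂ (inj₂ pz≡b))
      only : ∀ x y → IncidentTo G a b x y → colouring x y ≡ just (colour z) → SameEdge z (p z) x y
      only x y inc cxy with colouring≡just cxy
      ... | inj₁ (sxy@(_ , px≡y) , cx) with unique x (near-of-incident la e sxy inc) cx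
      ...   | refl = inj₁ (refl , px≡y)
      only x y inc cxy | inj₂ (syx@(_ , py≡x) , cy)
        with unique y (near-of-incident la e syx (incidentTo-flip G inc)) cy
      ...   | refl = inj₂ (refl , py≡x)

    satisfied : ∀ u v → Edge G u v → Satisfied G colouring u v
    satisfied u v e with side u ≟ᵇ false
    ... | yes lu = satisfied-left lu e
    ... | no ¬lu = satisfied-sym G (satisfied-left (neighbour-of-right-is-left e ¬lu) (edge-sym G e))

  three-colourable : NoIsolated G → SCFColourable G 3
  three-colourable noIsolated with stable-choice noIsolated
  ... | p , chooses , stable = colouring , colouring-sym , satisfied
    where open Colouring p chooses stable

theorem1 : (n : ℕ) (G : Graph n) → Bipartite G → NoIsolated G → SCFColourable G 3
theorem1 n G (side , bipartite) = Bipartition.three-colourable G side bipartite
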